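{- For integers $t\ge s\ge 0$ and $n\ge 1$, and an indeterminate $\mu$, \[ D_{s,t}(n)=\left(\prod_{i=0}^{t-s-1}\frac{(\mu+i+s-1)_n}{(i+s+1)_n}\right)\cdot D_{t,s}(n). \]
   Context: $\mu$ is an indeterminate and all quantities lie in $\mathbb{Q}(\mu)$. For integers $s,t$ and $n\ge1$, $D_{s,t}(n)$ denotes the $n\times n$ determinant $\det\bigl(\delta_{i,j}+\binom{\mu+i+j-2}{j}\bigr)$ with row index $i$ running over $s\le i<s+n$ and column index $j$ over $t\le j<t+n$; here $\delta_{i,j}$ is the Kronecker delta and $\binom{x}{j}=x(x-1)\cdots(x-j+1)/j!$ for integers $j\ge0$, $\binom{x}{j}=0$ for $j<0$. The Pochhammer symbol is $(x)_k=x(x+1)\cdots(x+k-1)$ for $k>0$, $(x)_0=1$. An empty product equals $1$. -}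

module Defs where

open import Data.Nat as ℕ using (ℕ; zero; suc; NonZero)
open import Data.Nat.Properties using (m*n≢0)
open import Data.Integer as ℤ using (ℤ)
open import Data.Rational using (ℚ; 0ℚ; 1ℚ; _+_; _*_; _-_; -_; _/_)
open import Data.Fin using (Fin; zero; suc; toℕ; punchIn)

ℕtoℚ : ℕ → ℚ
ℕtoℚ k = ℤ.+ k / 1

-- Generalized binomial coefficient  binom x j = x(x-1)...(x-j+1)/j!  for j ≥ 0
-- (only nonnegative j occur in the statement since columns j ≥ t ≥ 0).
fallingℚ : ℚ → ℕ → ℚ
fallingℚ x zero    = 1ℚ
fallingℚ x (suc j) = fallingℚ x j * (x - ℕtoℚ j)

factℕ : ℕ → ℕ
factℕ zero    = 1
factℕ (suc j) = suc j ℕ.* factℕ j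

factℕ-nz : ∀ j → NonZero (factℕ j)
factℕ-nz zero    = _
factℕ-nz (suc j) = m*n≢0 (suc j) (factℕ j) {{_}} {{factℕ-nz j}}

binom : ℚ → ℕ → ℚ
binom x j = fallingℚ x j * (_/_ (ℤ.+ 1) (factℕ j) {{factℕ-nz j}})

poch : ℚ → ℕ → ℚ
poch x zero    = 1ℚ
poch x (suc k) = poch x k * (x + ℕtoℚ k)

pochSuc : ℕ → ℕ → ℕ
pochSuc m zero    = 1
pochSuc m (suc k) = pochSuc m k ℕ.* suc (m ℕ.+ k)

pochSuc-nz : ∀ m k → NonZero (pochSuc m k)
pochSuc-nz m zero    = _
pochSuc-nz m (suc k) = m*n≢0 (pochSuc m k) (suc (m ℕ.+ k)) {{pochSuc-nz m k}} {{_}}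

invPochSuc : ℕ → ℕ → ℚ
invPochSuc m k = _/_ (ℤ.+ 1) (pochSuc m k) {{pochSuc-nz m k}}

Σ< : (n : ℕ) → (ℕ → ℚ) → ℚ
Σ< zero    f = 0ℚ
Σ< (suc n) f = Σ< n f + f n

Π< : (n : ℕ) → (ℕ → ℚ) → ℚ
Π< zero    f = 1ℚ
Π< (suc n) f = Π< n f * f n

ΣFin : (n : ℕ) → (Fin n → ℚ) → ℚ
ΣFin zero    f = 0ℚ
ΣFin (suc n) f = f zero + ΣFin n (λ j → f (suc j))

sign : ℕ → ℚ
sign zero    = 1ℚ
sign (suc k) = - sign k

det : (n : ℕ) → (Fin n → Fin n → ℚ) → ℚ
det zero    M = 1ℚ
det (suc n) M =
  ΣFin (suc n) (λ j → sign (toℕ j) * M zero j * det n (λ a b → M (suc a) (punchIn j b)))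

δ : ℕ → ℕ → ℚ
δ zero    zero    = 1ℚ
δ zero    (suc j) = 0ℚ
δ (suc i) zero    = 0ℚ
δ (suc i) (suc j) = δ i j

entry : ℚ → ℕ → ℕ → ℚ
entry μ i j = δ i j + binom (μ + ℕtoℚ (i ℕ.+ j) - ℕtoℚ 2) j

-- D_{s,t}(n), evaluated at μ ∈ ℚ: rows i = s..s+n-1, columns j = t..t+n-1.
D : ℚ → ℕ → ℕ → ℕ → ℚ
D μ s t n = det n (λ a b → entry μ (s ℕ.+ toℕ a) (t ℕ.+ toℕ b))

factor : ℚ → ℕ → ℕ → ℕ → ℚ
factor μ s n i = poch (μ + ℕtoℚ (i ℕ.+ s) - 1ℚ) n * invPochSuc (i ℕ.+ s) n

{-# OPTIONS --safe #-}
module Submission where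

-- With the weights w_i = (μ-1)_i / i!, the matrix  w_i · (δ_{i,j} + binom(μ+i+j-2, j))  is
-- symmetric in i and j, because w_i · binom(μ+i+j-2, j) = (μ-1)_{i+j} / (i! j!).  Scaling the
-- rows of D_{s,t}(n) by w_s, …, w_{s+n-1} therefore gives the transpose of D_{t,s}(n) scaled
-- by w_t, …, w_{t+n-1}, and ∏_a w_{t+a} / ∏_a w_{s+a} telescopes to the product of the factors
-- (μ+i+s-1)_n / (i+s+1)_n.  Dividing by ∏_a w_{s+a} is legitimate only when the weights do not
-- vanish, e.g. at the integers μ ≥ 2; as both sides are polynomials in μ that agree at
-- infinitely many points, they agree everywhere.

open import Defs
open import Data.Nat using (ℕ; _≤_; _∸_; _≥_)
open import Data.Rational using (ℚ; _*_)
open import Relation.Binary.PropositionalEquality using (_≡_)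

open import Level using (0ℓ)
open import Function using (_∘_)
open import Relation.Nullary.Decidable using (dec⇒maybe)
open import Data.Product using (∃-syntax; Σ-syntax; _,_)
open import Data.Nat as ℕ using (zero; suc)
import Data.Nat.Properties as ℕ
import Data.Integer as ℤ
import Data.Integer.Properties as ℤ
open import Data.Rational
  using (0ℚ; 1ℚ; _+_; _-_; -_; _/_; 1/_; fromℚᵘ; toℚᵘ; NonZero; Positive; ≢-nonZero; *-1-rawMonoid)
open import Data.Rational.Properties
  using ( _≟_; +-*-commutativeRing; +-*-ring; +-0-group; *-1-commutativeMonoid
        ; toℚᵘ-fromℚᵘ; fromℚᵘ-toℚᵘ; fromℚᵘ-cong; fromℚᵘ-injective; toℚᵘ-homo-+; toℚᵘ-homo-*
        ; +-identityˡ; +-identityʳ; +-assoc; *-identityˡ; *-identityʳ; *-zeroˡ; *-zeroʳ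
        ; *-assoc; *-comm; *-distribˡ-+; *-inverseˡ
        ; pos⇒nonZero; normalize-pos; normalize-nonNeg; pos*pos⇒pos; pos+nonNeg⇒pos)
open import Data.Rational.Unnormalised as ℚᵘ using (ℚᵘ; mkℚᵘ; *≡*)
import Data.Rational.Unnormalised.Properties as ℚᵘ
open import Data.Fin using (Fin; zero; suc; toℕ; punchIn)
open import Data.Vec using (Vec; []; _∷_; map)
open import Relation.Binary.PropositionalEquality
  using (_≗_; refl; sym; trans; cong; cong₂; subst; module ≡-Reasoning)
open import Algebra.Bundles using (Ring; CommutativeMonoid)
open import Algebra.Properties.Group +-0-group using (x∙y⁻¹≈ε⇒x≈y; x≈y⇒x∙y⁻¹≈ε)
open import Algebra.Properties.CommutativeSemigroup
  (CommutativeMonoid.commutativeSemigroup *-1-commutativeMonoid) using (interchange; xy∙z≈xz∙y)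
open import Algebra.Properties.Semiring.Sum (Ring.semiring +-*-ring)
  using (sum; ∑-comm; *-distribˡ-sum)
open import Algebra.Definitions.RawMonoid *-1-rawMonoid using () renaming (sum to product)
open import Tactic.RingSolver using (solve-∀)
open import Tactic.RingSolver.Core.AlmostCommutativeRing
  using (AlmostCommutativeRing; fromCommutativeRing)

open ≡-Reasoning

ℚ-ring : AlmostCommutativeRing 0ℓ 0ℓ
ℚ-ring = fromCommutativeRing +-*-commutativeRing (λ x → dec⇒maybe (0ℚ ≟ x))

fromℚᵘ-homo-+ : ∀ p q → fromℚᵘ (p ℚᵘ.+ q) ≡ fromℚᵘ p + fromℚᵘ q
fromℚᵘ-homo-+ p q = begin
  fromℚᵘ (p ℚᵘ.+ q)
    ≡⟨ fromℚᵘ-cong (ℚᵘ.+-cong (ℚᵘ.≃-sym (toℚᵘ-fromℚᵘ p)) (ℚᵘ.≃-sym (toℚᵘ-fromℚᵘ q))) ⟩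
  fromℚᵘ (toℚᵘ (fromℚᵘ p) ℚᵘ.+ toℚᵘ (fromℚᵘ q))
    ≡⟨ fromℚᵘ-cong (ℚᵘ.≃-sym (toℚᵘ-homo-+ (fromℚᵘ p) (fromℚᵘ q))) ⟩
  fromℚᵘ (toℚᵘ (fromℚᵘ p + fromℚᵘ q))
    ≡⟨ fromℚᵘ-toℚᵘ (fromℚᵘ p + fromℚᵘ q) ⟩
  fromℚᵘ p + fromℚᵘ q ∎

fromℚᵘ-homo-* : ∀ p q → fromℚᵘ (p ℚᵘ.* q) ≡ fromℚᵘ p * fromℚᵘ q
fromℚᵘ-homo-* p q = begin
  fromℚᵘ (p ℚᵘ.* q)
    ≡⟨ fromℚᵘ-cong (ℚᵘ.*-cong (ℚᵘ.≃-sym (toℚᵘ-fromℚᵘ p)) (ℚᵘ.≃-sym (toℚᵘ-fromℚᵘ q))) ⟩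
  fromℚᵘ (toℚᵘ (fromℚᵘ p) ℚᵘ.* toℚᵘ (fromℚᵘ q))
    ≡⟨ fromℚᵘ-cong (ℚᵘ.≃-sym (toℚᵘ-homo-* (fromℚᵘ p) (fromℚᵘ q))) ⟩
  fromℚᵘ (toℚᵘ (fromℚᵘ p * fromℚᵘ q))
    ≡⟨ fromℚᵘ-toℚᵘ (fromℚᵘ p * fromℚᵘ q) ⟩
  fromℚᵘ p * fromℚᵘ q ∎

-- ℕtoℚ n reduces to fromℚᵘ (ℕtoℚᵘ n).
ℕtoℚᵘ : ℕ → ℚᵘ
ℕtoℚᵘ n = mkℚᵘ (ℤ.+ n) 0

ℕtoℚ-+ : ∀ m n → ℕtoℚ (m ℕ.+ n) ≡ ℕtoℚ m + ℕtoℚ n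
ℕtoℚ-+ m n = begin
  fromℚᵘ (ℕtoℚᵘ (m ℕ.+ n))          ≡⟨ fromℚᵘ-cong {ℕtoℚᵘ (m ℕ.+ n)} {ℕtoℚᵘ m ℚᵘ.+ ℕtoℚᵘ n}
                                                   (*≡* numerators) ⟩
  fromℚᵘ (ℕtoℚᵘ m ℚᵘ.+ ℕtoℚᵘ n)     ≡⟨ fromℚᵘ-homo-+ (ℕtoℚᵘ m) (ℕtoℚᵘ n) ⟩
  ℕtoℚ m + ℕtoℚ n                  ∎
  where
  numerators : ℤ.+ (m ℕ.+ n) ℤ.* ℤ.+ 1 ≡ (ℤ.+ m ℤ.* ℤ.+ 1 ℤ.+ ℤ.+ n ℤ.* ℤ.+ 1) ℤ.* ℤ.+ 1
  numerators = begin
    ℤ.+ (m ℕ.+ n) ℤ.* ℤ.+ 1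
      ≡⟨ ℤ.*-identityʳ (ℤ.+ (m ℕ.+ n)) ⟩
    ℤ.+ (m ℕ.+ n)
      ≡⟨ ℤ.pos-+ m n ⟩
    ℤ.+ m ℤ.+ ℤ.+ n
      ≡⟨ sym (cong₂ ℤ._+_ (ℤ.*-identityʳ (ℤ.+ m)) (ℤ.*-identityʳ (ℤ.+ n))) ⟩
    ℤ.+ m ℤ.* ℤ.+ 1 ℤ.+ ℤ.+ n ℤ.* ℤ.+ 1
      ≡⟨ sym (ℤ.*-identityʳ (ℤ.+ m ℤ.* ℤ.+ 1 ℤ.+ ℤ.+ n ℤ.* ℤ.+ 1)) ⟩
    (ℤ.+ m ℤ.* ℤ.+ 1 ℤ.+ ℤ.+ n ℤ.* ℤ.+ 1) ℤ.* ℤ.+ 1 ∎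

ℕtoℚ-injective : ∀ {m n} → ℕtoℚ m ≡ ℕtoℚ n → m ≡ n
ℕtoℚ-injective {m} {n} eq with fromℚᵘ-injective {ℕtoℚᵘ m} {ℕtoℚᵘ n} eq
... | *≡* m*1≡n*1 = ℤ.+-injective (begin
  ℤ.+ m           ≡⟨ sym (ℤ.*-identityʳ (ℤ.+ m)) ⟩
  ℤ.+ m ℤ.* ℤ.+ 1 ≡⟨ m*1≡n*1 ⟩
  ℤ.+ n ℤ.* ℤ.+ 1 ≡⟨ ℤ.*-identityʳ (ℤ.+ n) ⟩
  ℤ.+ n           ∎)

/-* : ∀ i j a b .{{_ : ℕ.NonZero a}} .{{_ : ℕ.NonZero b}} .{{_ : ℕ.NonZero (a ℕ.* b)}} →
      (i ℤ.* j) / (a ℕ.* b) ≡ (i / a) * (j / b)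
/-* i j (suc a) (suc b) =
  trans (fromℚᵘ-cong {mkℚᵘ (i ℤ.* j) (b ℕ.+ a ℕ.* suc b)} {mkℚᵘ i a ℚᵘ.* mkℚᵘ j b} (*≡* refl))
        (fromℚᵘ-homo-* (mkℚᵘ i a) (mkℚᵘ j b))

*-cancelˡ-≡ : ∀ p .{{_ : NonZero p}} {x y} → p * x ≡ p * y → x ≡ y
*-cancelˡ-≡ p {x} {y} px≡py = begin
  x              ≡⟨ recover x ⟩
  1/ p * (p * x) ≡⟨ cong (1/ p *_) px≡py ⟩
  1/ p * (p * y) ≡⟨ sym (recover y) ⟩
  y              ∎
  where
  recover : ∀ z → z ≡ 1/ p * (p * z)
  recover z = begin
    z              ≡⟨ sym (*-identityˡ z) ⟩
    1ℚ * z         ≡⟨ cong (_* z) (sym (*-inverseˡ p)) ⟩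
    1/ p * p * z   ≡⟨ *-assoc (1/ p) p z ⟩
    1/ p * (p * z) ∎

ΣFin≡sum : ∀ n (f : Fin n → ℚ) → ΣFin n f ≡ sum f
ΣFin≡sum zero    f = refl
ΣFin≡sum (suc n) f = cong (f zero +_) (ΣFin≡sum n (f ∘ suc))

ΣFin-cong : ∀ n {f g : Fin n → ℚ} → f ≗ g → ΣFin n f ≡ ΣFin n g
ΣFin-cong zero    f≗g = refl
ΣFin-cong (suc n) f≗g = cong₂ _+_ (f≗g zero) (ΣFin-cong n (f≗g ∘ suc))

ΣFin-*ˡ : ∀ n c (f : Fin n → ℚ) → c * ΣFin n f ≡ ΣFin n (λ j → c * f j)
ΣFin-*ˡ n c f = begin
  c * ΣFin n f            ≡⟨ cong (c *_) (ΣFin≡sum n f) ⟩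
  c * sum f               ≡⟨ *-distribˡ-sum c f ⟩
  sum (λ j → c * f j)     ≡⟨ sym (ΣFin≡sum n (λ j → c * f j)) ⟩
  ΣFin n (λ j → c * f j)  ∎

ΣFin-comm : ∀ m n (f : Fin m → Fin n → ℚ) →
            ΣFin m (λ i → ΣFin n (f i)) ≡ ΣFin n (λ j → ΣFin m (λ i → f i j))
ΣFin-comm m n f = begin
  ΣFin m (λ i → ΣFin n (f i))          ≡⟨ ΣFin-cong m (λ i → ΣFin≡sum n (f i)) ⟩
  ΣFin m (λ i → sum (f i))             ≡⟨ ΣFin≡sum m (λ i → sum (f i)) ⟩
  sum (λ i → sum (f i))                ≡⟨ ∑-comm f ⟩
  sum (λ j → sum (λ i → f i j))        ≡⟨ sym (ΣFin≡sum n (λ j → sum (λ i → f i j))) ⟩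
  ΣFin n (λ j → sum (λ i → f i j))     ≡⟨ sym (ΣFin-cong n (λ j → ΣFin≡sum m (λ i → f i j))) ⟩
  ΣFin n (λ j → ΣFin m (λ i → f i j))  ∎

Π<-cong : ∀ n {f g : ℕ → ℚ} → f ≗ g → Π< n f ≡ Π< n g
Π<-cong zero    f≗g = refl
Π<-cong (suc n) f≗g = cong₂ _*_ (Π<-cong n f≗g) (f≗g n)

Π<-distrib-* : ∀ n (f g : ℕ → ℚ) → Π< n (λ i → f i * g i) ≡ Π< n f * Π< n g
Π<-distrib-* zero    f g = refl
Π<-distrib-* (suc n) f g = begin
  Π< n (λ i → f i * g i) * (f n * g n)  ≡⟨ cong (_* (f n * g n)) (Π<-distrib-* n f g) ⟩
  Π< n f * Π< n g * (f n * g n)         ≡⟨ interchange (Π< n f) (Π< n g) (f n) (g n) ⟩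
  Π< n f * f n * (Π< n g * g n)         ∎

Π<-suc : ∀ n (f : ℕ → ℚ) → Π< (suc n) f ≡ f 0 * Π< n (f ∘ suc)
Π<-suc zero    f = *-comm 1ℚ (f 0)
Π<-suc (suc n) f = begin
  Π< (suc n) f * f (suc n)          ≡⟨ cong (_* f (suc n)) (Π<-suc n f) ⟩
  f 0 * Π< n (f ∘ suc) * f (suc n)  ≡⟨ *-assoc (f 0) (Π< n (f ∘ suc)) (f (suc n)) ⟩
  f 0 * Π< (suc n) (f ∘ suc)        ∎

product≡Π< : ∀ n (f : ℕ → ℚ) → product (λ (a : Fin n) → f (toℕ a)) ≡ Π< n f
product≡Π< zero    f = refl
product≡Π< (suc n) f = trans (cong (f 0 *_) (product≡Π< n (f ∘ suc))) (sym (Π<-suc n f))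

Π<-positive : ∀ n (f : ℕ → ℚ) → (∀ i → Positive (f i)) → Positive (Π< n f)
Π<-positive zero    f pos = normalize-pos 1 1
Π<-positive (suc n) f pos = pos*pos⇒pos (Π< n f) {{Π<-positive n f pos}} (f n) {{pos n}}

-- Determinants

det-cong : ∀ n {M N : Fin n → Fin n → ℚ} → (∀ a b → M a b ≡ N a b) → det n M ≡ det n N
det-cong zero    M≡N = refl
det-cong (suc n) M≡N = ΣFin-cong (suc n) λ j →
  cong₂ (λ x y → sign (toℕ j) * x * y) (M≡N zero j) (det-cong n (λ a b → M≡N (suc a) (punchIn j b)))

columnExpansion : (n : ℕ) → (Fin n → Fin n → ℚ) → ℚ
columnExpansion zero    M = 1ℚ
columnExpansion (suc n) M =
  ΣFin (suc n) (λ i → sign (toℕ i) * M i zero * det n (λ a b → M (punchIn i a) (suc b)))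

-- Expanding the minors of the first row along their first column, and the minors of the
-- first column along their first row, leads to the same double sum.
det≡columnExpansion : ∀ n M → det n M ≡ columnExpansion n M
det≡columnExpansion zero          M = refl
det≡columnExpansion (suc zero)    M = refl
det≡columnExpansion (suc (suc m)) M = cong (first-term +_) (begin
  ΣFin (suc m) (λ j → (- sign (toℕ j)) * M zero (suc j) * det (suc m) (row-minor j))
    ≡⟨ ΣFin-cong (suc m) (λ j → cong ((- sign (toℕ j)) * M zero (suc j) *_)
                                     (det≡columnExpansion (suc m) (row-minor j))) ⟩
  ΣFin (suc m) (λ j → (- sign (toℕ j)) * M zero (suc j) *
    ΣFin (suc m) (λ i → sign (toℕ i) * M (suc i) zero * det m (minor i j)))
    ≡⟨ swap-cofactors (sign ∘ toℕ) (λ j → M zero (suc j)) (sign ∘ toℕ) (λ i → M (suc i) zero)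
                      (λ i j → det m (minor i j)) ⟩
  ΣFin (suc m) (λ i → (- sign (toℕ i)) * M (suc i) zero *
    ΣFin (suc m) (λ j → sign (toℕ j) * M zero (suc j) * det m (minor i j))) ∎)
  where
  first-term : ℚ
  first-term = sign 0 * M zero zero * det (suc m) (λ a b → M (suc a) (suc b))

  row-minor : Fin (suc m) → Fin (suc m) → Fin (suc m) → ℚ
  row-minor j a b = M (suc a) (punchIn (suc j) b)

  minor : Fin (suc m) → Fin (suc m) → Fin m → Fin m → ℚ
  minor i j a b = M (suc (punchIn i a)) (suc (punchIn j b))

  swap-cofactors : ∀ (u A v B : Fin (suc m) → ℚ) (X : Fin (suc m) → Fin (suc m) → ℚ) →
    ΣFin (suc m) (λ j → (- u j) * A j * ΣFin (suc m) (λ i → v i * B i * X i j)) ≡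
    ΣFin (suc m) (λ i → (- v i) * B i * ΣFin (suc m) (λ j → u j * A j * X i j))
  swap-cofactors u A v B X = begin
    ΣFin (suc m) (λ j → (- u j) * A j * ΣFin (suc m) (λ i → v i * B i * X i j))
      ≡⟨ ΣFin-cong (suc m) (λ j → ΣFin-*ˡ (suc m) ((- u j) * A j) (λ i → v i * B i * X i j)) ⟩
    ΣFin (suc m) (λ j → ΣFin (suc m) (λ i → (- u j) * A j * (v i * B i * X i j)))
      ≡⟨ ΣFin-cong (suc m) (λ j → ΣFin-cong (suc m) (λ i →
           rearrange (u j) (A j) (v i) (B i) (X i j))) ⟩
    ΣFin (suc m) (λ j → ΣFin (suc m) (λ i → (- v i) * B i * (u j * A j * X i j)))
      ≡⟨ ΣFin-comm (suc m) (suc m) (λ j i → (- v i) * B i * (u j * A j * X i j)) ⟩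
    ΣFin (suc m) (λ i → ΣFin (suc m) (λ j → (- v i) * B i * (u j * A j * X i j)))
      ≡⟨ sym (ΣFin-cong (suc m) (λ i → ΣFin-*ˡ (suc m) ((- v i) * B i) (λ j → u j * A j * X i j))) ⟩
    ΣFin (suc m) (λ i → (- v i) * B i * ΣFin (suc m) (λ j → u j * A j * X i j)) ∎
    where
    rearrange : ∀ a b c d x → (- a) * b * (c * d * x) ≡ (- c) * d * (a * b * x)
    rearrange = solve-∀ ℚ-ring

det-transpose : ∀ n (M : Fin n → Fin n → ℚ) → det n (λ a b → M b a) ≡ det n M
det-transpose zero    M = refl
det-transpose (suc n) M = begin
  det (suc n) (λ a b → M b a)
    ≡⟨ ΣFin-cong (suc n) (λ j → cong (sign (toℕ j) * M j zero *_)
                                     (det-transpose n (λ a b → M (punchIn j a) (suc b)))) ⟩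
  columnExpansion (suc n) M
    ≡⟨ sym (det≡columnExpansion (suc n) M) ⟩
  det (suc n) M ∎

det-scaleRows : ∀ n (r : Fin n → ℚ) M → det n (λ a b → r a * M a b) ≡ product r * det n M
det-scaleRows zero    r M = refl
det-scaleRows (suc n) r M = begin
  ΣFin (suc n) (λ j → sign (toℕ j) * (r zero * M zero j) * det n (λ a b → r (suc a) * minor j a b))
    ≡⟨ ΣFin-cong (suc n) (λ j → cong (sign (toℕ j) * (r zero * M zero j) *_)
                                     (det-scaleRows n (r ∘ suc) (minor j))) ⟩
  ΣFin (suc n) (λ j → sign (toℕ j) * (r zero * M zero j) * (product (r ∘ suc) * det n (minor j)))
    ≡⟨ ΣFin-cong (suc n) (λ j → rearrange (sign (toℕ j)) (r zero) (M zero j)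
                                          (product (r ∘ suc)) (det n (minor j))) ⟩
  ΣFin (suc n) (λ j → product r * (sign (toℕ j) * M zero j * det n (minor j)))
    ≡⟨ sym (ΣFin-*ˡ (suc n) (product r) (λ j → sign (toℕ j) * M zero j * det n (minor j))) ⟩
  product r * det (suc n) M ∎
  where
  minor : Fin (suc n) → Fin n → Fin n → ℚ
  minor j a b = M (suc a) (punchIn j b)

  rearrange : ∀ s x y p d → s * (x * y) * (p * d) ≡ (x * p) * (s * y * d)
  rearrange = solve-∀ ℚ-ring

-- Polynomial functions

eval : ∀ {n} → Vec ℚ n → ℚ → ℚ
eval []       x = 0ℚ
eval (c ∷ cs) x = c + x * eval cs x

quotient : ∀ {n} → ℚ → Vec ℚ (suc n) → Vec ℚ n
quotient a (c ∷ [])     = []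
quotient a (c ∷ d ∷ cs) = eval (d ∷ cs) a ∷ quotient a (d ∷ cs)

eval-quotient : ∀ {n} a (cs : Vec ℚ (suc n)) x →
                eval cs x ≡ eval cs a + (x - a) * eval (quotient a cs) x
eval-quotient a (c ∷ []) x = constant c x a
  where
  constant : ∀ c x a → c + x * 0ℚ ≡ c + a * 0ℚ + (x - a) * 0ℚ
  constant = solve-∀ ℚ-ring
eval-quotient a (c ∷ ds@(_ ∷ _)) x = begin
  c + x * eval ds x
    ≡⟨ cong (λ z → c + x * z) (eval-quotient a ds x) ⟩
  c + x * (eval ds a + (x - a) * eval (quotient a ds) x)
    ≡⟨ regroup c x a (eval ds a) (eval (quotient a ds) x) ⟩
  c + a * eval ds a + (x - a) * (eval ds a + x * eval (quotient a ds) x) ∎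
  where
  regroup : ∀ c x a p q → c + x * (p + (x - a) * q) ≡ c + a * p + (x - a) * (p + x * q)
  regroup = solve-∀ ℚ-ring

eval-vanishing : ∀ {n} (cs : Vec ℚ n) (a : ℕ → ℚ) → (∀ {i j} → a i ≡ a j → i ≡ j) →
                 (∀ k → eval cs (a k) ≡ 0ℚ) → ∀ x → eval cs x ≡ 0ℚ
eval-vanishing {zero}  [] a a-injective roots x = refl
eval-vanishing {suc n} cs a a-injective roots x = begin
  eval cs x                             ≡⟨ eval-quotient (a 0) cs x ⟩
  eval cs (a 0) + (x - a 0) * eval q x  ≡⟨ cong₂ (λ u v → u + (x - a 0) * v) (roots 0) q-vanishes ⟩
  0ℚ + (x - a 0) * 0ℚ                   ≡⟨ annihilate (x - a 0) ⟩
  0ℚ                                    ∎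
  where
  q : Vec ℚ n
  q = quotient (a 0) cs

  annihilate : ∀ y → 0ℚ + y * 0ℚ ≡ 0ℚ
  annihilate = solve-∀ ℚ-ring

  q-roots : ∀ k → eval q (a (suc k)) ≡ 0ℚ
  q-roots k = *-cancelˡ-≡ d {{≢-nonZero (ℕ.1+n≢0 ∘ a-injective ∘ x∙y⁻¹≈ε⇒x≈y _ _)}} (begin
    d * eval q (a (suc k))                  ≡⟨ sym (+-identityˡ (d * eval q (a (suc k)))) ⟩
    0ℚ + d * eval q (a (suc k))             ≡⟨ cong (_+ d * eval q (a (suc k))) (sym (roots 0)) ⟩
    eval cs (a 0) + d * eval q (a (suc k))  ≡⟨ sym (eval-quotient (a 0) cs (a (suc k))) ⟩
    eval cs (a (suc k))                     ≡⟨ roots (suc k) ⟩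
    0ℚ                                      ≡⟨ sym (*-zeroʳ d) ⟩
    d * 0ℚ                                  ∎)
    where
    d = a (suc k) - a 0

  q-vanishes : eval q x ≡ 0ℚ
  q-vanishes = eval-vanishing q (a ∘ suc) (ℕ.suc-injective ∘ a-injective) q-roots x

IsPolynomial : (ℚ → ℚ) → Set
IsPolynomial f = ∃[ n ] Σ[ cs ∈ Vec ℚ n ] (∀ x → f x ≡ eval cs x)

IsPolynomial-resp : ∀ {f g} → f ≗ g → IsPolynomial f → IsPolynomial g
IsPolynomial-resp f≗g (n , cs , f≡cs) = n , cs , λ x → trans (sym (f≗g x)) (f≡cs x)

_⊕_ : ∀ {m n} → Vec ℚ m → Vec ℚ n → Vec ℚ (m ℕ.⊔ n)
[]       ⊕ ds       = ds
(c ∷ cs) ⊕ []       = c ∷ cs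
(c ∷ cs) ⊕ (d ∷ ds) = c + d ∷ cs ⊕ ds

eval-⊕ : ∀ {m n} (cs : Vec ℚ m) (ds : Vec ℚ n) x → eval (cs ⊕ ds) x ≡ eval cs x + eval ds x
eval-⊕ []       ds       x = sym (+-identityˡ (eval ds x))
eval-⊕ (c ∷ cs) []       x = sym (+-identityʳ (eval (c ∷ cs) x))
eval-⊕ (c ∷ cs) (d ∷ ds) x = begin
  c + d + x * eval (cs ⊕ ds) x             ≡⟨ cong (λ z → c + d + x * z) (eval-⊕ cs ds x) ⟩
  c + d + x * (eval cs x + eval ds x)      ≡⟨ regroup c d x (eval cs x) (eval ds x) ⟩
  c + x * eval cs x + (d + x * eval ds x)  ∎
  where
  regroup : ∀ c d x p q → c + d + x * (p + q) ≡ c + x * p + (d + x * q)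
  regroup = solve-∀ ℚ-ring

eval-scale : ∀ {n} c (cs : Vec ℚ n) x → eval (map (c *_) cs) x ≡ c * eval cs x
eval-scale c []       x = sym (*-zeroʳ c)
eval-scale c (d ∷ cs) x = begin
  c * d + x * eval (map (c *_) cs) x  ≡⟨ cong (λ z → c * d + x * z) (eval-scale c cs x) ⟩
  c * d + x * (c * eval cs x)         ≡⟨ regroup c d x (eval cs x) ⟩
  c * (d + x * eval cs x)             ∎
  where
  regroup : ∀ c d x p → c * d + x * (c * p) ≡ c * (d + x * p)
  regroup = solve-∀ ℚ-ring

poly-const : ∀ c → IsPolynomial (λ _ → c)
poly-const c = 1 , c ∷ [] , λ x → sym (constant c x)
  where
  constant : ∀ c x → c + x * 0ℚ ≡ c
  constant = solve-∀ ℚ-ring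

poly-id : IsPolynomial (λ x → x)
poly-id = 2 , 0ℚ ∷ 1ℚ ∷ [] , λ x → sym (linear x)
  where
  linear : ∀ x → 0ℚ + x * (1ℚ + x * 0ℚ) ≡ x
  linear = solve-∀ ℚ-ring

poly-+ : ∀ {f g} → IsPolynomial f → IsPolynomial g → IsPolynomial (λ x → f x + g x)
poly-+ (_ , cs , f≡cs) (_ , ds , g≡ds) =
  _ , cs ⊕ ds , λ x → trans (cong₂ _+_ (f≡cs x) (g≡ds x)) (sym (eval-⊕ cs ds x))

poly-scale : ∀ c {f} → IsPolynomial f → IsPolynomial (λ x → c * f x)
poly-scale c (_ , cs , f≡cs) =
  _ , map (c *_) cs , λ x → trans (cong (c *_) (f≡cs x)) (sym (eval-scale c cs x))

poly-x* : ∀ {f} → IsPolynomial f → IsPolynomial (λ x → x * f x)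
poly-x* (_ , cs , f≡cs) =
  _ , 0ℚ ∷ cs , λ x → trans (cong (x *_) (f≡cs x)) (sym (+-identityˡ (x * eval cs x)))

poly-* : ∀ {f g} → IsPolynomial f → IsPolynomial g → IsPolynomial (λ x → f x * g x)
poly-* {f} {g} (_ , cs , f≡cs) pg =
  IsPolynomial-resp (λ x → cong (_* g x) (sym (f≡cs x))) (times-g cs)
  where
  horner : ∀ c x p q → (c + x * p) * q ≡ c * q + x * (p * q)
  horner = solve-∀ ℚ-ring

  times-g : ∀ {n} (cs : Vec ℚ n) → IsPolynomial (λ x → eval cs x * g x)
  times-g []       = IsPolynomial-resp (λ x → sym (*-zeroˡ (g x))) (poly-const 0ℚ)
  times-g (c ∷ cs) = IsPolynomial-resp (λ x → sym (horner c x (eval cs x) (g x)))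
                                       (poly-+ (poly-scale c pg) (poly-x* (times-g cs)))

poly-- : ∀ {f g} → IsPolynomial f → IsPolynomial g → IsPolynomial (λ x → f x - g x)
poly-- {g = g} pf pg = poly-+ pf (IsPolynomial-resp (λ x → negate (g x)) (poly-scale (- 1ℚ) pg))
  where
  negate : ∀ y → (- 1ℚ) * y ≡ - y
  negate = solve-∀ ℚ-ring

poly-ΣFin : ∀ n (F : ℚ → Fin n → ℚ) → (∀ j → IsPolynomial (λ x → F x j)) →
            IsPolynomial (λ x → ΣFin n (F x))
poly-ΣFin zero    F pF = poly-const 0ℚ
poly-ΣFin (suc n) F pF = poly-+ (pF zero) (poly-ΣFin n (λ x j → F x (suc j)) (pF ∘ suc))

poly-Π< : ∀ n (F : ℚ → ℕ → ℚ) → (∀ i → IsPolynomial (λ x → F x i)) →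
          IsPolynomial (λ x → Π< n (F x))
poly-Π< zero    F pF = poly-const 1ℚ
poly-Π< (suc n) F pF = poly-* (poly-Π< n F pF) (pF n)

poly-det : ∀ n (M : ℚ → Fin n → Fin n → ℚ) → (∀ a b → IsPolynomial (λ x → M x a b)) →
           IsPolynomial (λ x → det n (M x))
poly-det zero    M pM = poly-const 1ℚ
poly-det (suc n) M pM = poly-ΣFin (suc n) _ λ j →
  poly-* (poly-scale (sign (toℕ j)) (pM zero j))
         (poly-det n (λ x a b → M x (suc a) (punchIn j b)) (λ a b → pM (suc a) (punchIn j b)))

polynomial-identity : ∀ {f g} → IsPolynomial f → IsPolynomial g →
                      (a : ℕ → ℚ) → (∀ {i j} → a i ≡ a j → i ≡ j) →
                      (∀ k → f (a k) ≡ g (a k)) → f ≗ g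
polynomial-identity {f} {g} pf pg a a-injective agree x with poly-- pf pg
... | _ , cs , f-g≡cs = x∙y⁻¹≈ε⇒x≈y (f x) (g x) (begin
  f x - g x  ≡⟨ f-g≡cs x ⟩
  eval cs x  ≡⟨ eval-vanishing cs a a-injective roots x ⟩
  0ℚ         ∎)
  where
  roots : ∀ k → eval cs (a k) ≡ 0ℚ
  roots k = trans (sym (f-g≡cs (a k))) (x≈y⇒x∙y⁻¹≈ε (agree k))

invFact : ℕ → ℚ
invFact k = _/_ (ℤ.+ 1) (factℕ k) {{factℕ-nz k}}

poly-falling : ∀ {f} → IsPolynomial f → ∀ j → IsPolynomial (λ x → fallingℚ (f x) j)
poly-falling pf zero    = poly-const 1ℚ
poly-falling pf (suc j) = poly-* (poly-falling pf j) (poly-- pf (poly-const (ℕtoℚ j)))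

poly-poch : ∀ {f} → IsPolynomial f → ∀ j → IsPolynomial (λ x → poch (f x) j)
poly-poch pf zero    = poly-const 1ℚ
poly-poch pf (suc j) = poly-* (poly-poch pf j) (poly-+ pf (poly-const (ℕtoℚ j)))

poly-entry : ∀ i j → IsPolynomial (λ μ → entry μ i j)
poly-entry i j =
  poly-+ (poly-const (δ i j)) (poly-* (poly-falling shifted j) (poly-const (invFact j)))
  where
  shifted = poly-- (poly-+ poly-id (poly-const (ℕtoℚ (i ℕ.+ j)))) (poly-const (ℕtoℚ 2))

poly-D : ∀ s t n → IsPolynomial (λ μ → D μ s t n)
poly-D s t n = poly-det n _ (λ a b → poly-entry (s ℕ.+ toℕ a) (t ℕ.+ toℕ b))

poly-factor : ∀ s n i → IsPolynomial (λ μ → factor μ s n i)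
poly-factor s n i = poly-* (poly-poch shifted n) (poly-const (invPochSuc (i ℕ.+ s) n))
  where
  shifted = poly-- (poly-+ poly-id (poly-const (ℕtoℚ (i ℕ.+ s)))) (poly-const 1ℚ)

poch-+ : ∀ y i j → poch y (i ℕ.+ j) ≡ poch y i * poch (y + ℕtoℚ i) j
poch-+ y i zero    = trans (cong (poch y) (ℕ.+-identityʳ i)) (sym (*-identityʳ (poch y i)))
poch-+ y i (suc j) = begin
  poch y (i ℕ.+ suc j)
    ≡⟨ cong (poch y) (ℕ.+-suc i j) ⟩
  poch y (i ℕ.+ j) * (y + ℕtoℚ (i ℕ.+ j))
    ≡⟨ cong₂ _*_ (poch-+ y i j) (cong (y +_) (ℕtoℚ-+ i j)) ⟩
  poch y i * poch (y + ℕtoℚ i) j * (y + (ℕtoℚ i + ℕtoℚ j))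
    ≡⟨ regroup (poch y i) (poch (y + ℕtoℚ i) j) y (ℕtoℚ i) (ℕtoℚ j) ⟩
  poch y i * (poch (y + ℕtoℚ i) j * (y + ℕtoℚ i + ℕtoℚ j)) ∎
  where
  regroup : ∀ p q y a b → p * q * (y + (a + b)) ≡ p * (q * (y + a + b))
  regroup = solve-∀ ℚ-ring

poch-suc : ∀ y j → poch y (suc j) ≡ y * poch (y + 1ℚ) j
poch-suc y j = trans (poch-+ y 1 j) (cong (_* poch (y + 1ℚ) j) (unit y))
  where
  unit : ∀ y → 1ℚ * (y + 0ℚ) ≡ y
  unit = solve-∀ ℚ-ring

falling≡poch : ∀ y j → fallingℚ (y + ℕtoℚ j) j ≡ poch (y + 1ℚ) j
falling≡poch y zero    = refl
falling≡poch y (suc j) = begin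
  fallingℚ (y + ℕtoℚ (suc j)) j * (y + ℕtoℚ (suc j) - ℕtoℚ j)
    ≡⟨ cong (λ z → fallingℚ (y + z) j * (y + z - ℕtoℚ j)) (ℕtoℚ-+ 1 j) ⟩
  fallingℚ (y + (1ℚ + ℕtoℚ j)) j * (y + (1ℚ + ℕtoℚ j) - ℕtoℚ j)
    ≡⟨ cong₂ (λ u v → fallingℚ u j * v) (shift y (ℕtoℚ j)) (cancel y (ℕtoℚ j)) ⟩
  fallingℚ (y + 1ℚ + ℕtoℚ j) j * (y + 1ℚ)
    ≡⟨ cong (_* (y + 1ℚ)) (falling≡poch (y + 1ℚ) j) ⟩
  poch (y + 1ℚ + 1ℚ) j * (y + 1ℚ)
    ≡⟨ *-comm (poch (y + 1ℚ + 1ℚ) j) (y + 1ℚ) ⟩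
  (y + 1ℚ) * poch (y + 1ℚ + 1ℚ) j
    ≡⟨ sym (poch-suc (y + 1ℚ) j) ⟩
  poch (y + 1ℚ) (suc j) ∎
  where
  shift : ∀ y a → y + (1ℚ + a) ≡ y + 1ℚ + a
  shift = solve-∀ ℚ-ring
  cancel : ∀ y a → y + (1ℚ + a) - a ≡ y + 1ℚ
  cancel = solve-∀ ℚ-ring

binom≡poch : ∀ μ i j →
             binom (μ + ℕtoℚ (i ℕ.+ j) - ℕtoℚ 2) j ≡ poch (μ - 1ℚ + ℕtoℚ i) j * invFact j
binom≡poch μ i j = cong (_* invFact j) (begin
  fallingℚ (μ + ℕtoℚ (i ℕ.+ j) - ℕtoℚ 2) j
    ≡⟨ cong (λ z → fallingℚ (μ + z - ℕtoℚ 2) j) (ℕtoℚ-+ i j) ⟩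
  fallingℚ (μ + (ℕtoℚ i + ℕtoℚ j) - ℕtoℚ 2) j
    ≡⟨ cong (λ z → fallingℚ z j) (shift μ (ℕtoℚ i) (ℕtoℚ j)) ⟩
  fallingℚ (μ - ℕtoℚ 2 + ℕtoℚ i + ℕtoℚ j) j
    ≡⟨ falling≡poch (μ - ℕtoℚ 2 + ℕtoℚ i) j ⟩
  poch (μ - ℕtoℚ 2 + ℕtoℚ i + 1ℚ) j
    ≡⟨ cong (λ z → poch z j) (unshift μ (ℕtoℚ i)) ⟩
  poch (μ - 1ℚ + ℕtoℚ i) j ∎)
  where
  shift : ∀ μ a b → μ + (a + b) - (1ℚ + 1ℚ) ≡ μ - (1ℚ + 1ℚ) + a + b
  shift = solve-∀ ℚ-ring
  unshift : ∀ μ a → μ - (1ℚ + 1ℚ) + a + 1ℚ ≡ μ - 1ℚ + a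
  unshift = solve-∀ ℚ-ring

δ-swap : ∀ i j (g : ℕ → ℚ) → g i * δ i j ≡ g j * δ j i
δ-swap zero    zero    g = refl
δ-swap zero    (suc j) g = trans (*-zeroʳ (g 0)) (sym (*-zeroʳ (g (suc j))))
δ-swap (suc i) zero    g = trans (*-zeroʳ (g (suc i))) (sym (*-zeroʳ (g 0)))
δ-swap (suc i) (suc j) g = δ-swap i j (g ∘ suc)

-- The symmetrising weights

weight : ℚ → ℕ → ℚ
weight μ k = poch (μ - 1ℚ) k * invFact k

weight-*-binom : ∀ μ i j → weight μ i * binom (μ + ℕtoℚ (i ℕ.+ j) - ℕtoℚ 2) j ≡
                           poch (μ - 1ℚ) (i ℕ.+ j) * (invFact i * invFact j)
weight-*-binom μ i j = begin
  poch (μ - 1ℚ) i * invFact i * binom (μ + ℕtoℚ (i ℕ.+ j) - ℕtoℚ 2) j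
    ≡⟨ cong (weight μ i *_) (binom≡poch μ i j) ⟩
  poch (μ - 1ℚ) i * invFact i * (poch (μ - 1ℚ + ℕtoℚ i) j * invFact j)
    ≡⟨ interchange (poch (μ - 1ℚ) i) (invFact i) (poch (μ - 1ℚ + ℕtoℚ i) j) (invFact j) ⟩
  poch (μ - 1ℚ) i * poch (μ - 1ℚ + ℕtoℚ i) j * (invFact i * invFact j)
    ≡⟨ cong (_* (invFact i * invFact j)) (sym (poch-+ (μ - 1ℚ) i j)) ⟩
  poch (μ - 1ℚ) (i ℕ.+ j) * (invFact i * invFact j) ∎

weight-entry-symmetric : ∀ μ i j → weight μ i * entry μ i j ≡ weight μ j * entry μ j i
weight-entry-symmetric μ i j = begin
  weight μ i * (δ i j + b i j)             ≡⟨ *-distribˡ-+ (weight μ i) (δ i j) (b i j) ⟩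
  weight μ i * δ i j + weight μ i * b i j  ≡⟨ cong₂ _+_ (δ-swap i j (weight μ)) binomial-part ⟩
  weight μ j * δ j i + weight μ j * b j i  ≡⟨ sym (*-distribˡ-+ (weight μ j) (δ j i) (b j i)) ⟩
  weight μ j * (δ j i + b j i)             ∎
  where
  b : ℕ → ℕ → ℚ
  b i j = binom (μ + ℕtoℚ (i ℕ.+ j) - ℕtoℚ 2) j

  binomial-part : weight μ i * b i j ≡ weight μ j * b j i
  binomial-part = begin
    weight μ i * b i j
      ≡⟨ weight-*-binom μ i j ⟩
    poch (μ - 1ℚ) (i ℕ.+ j) * (invFact i * invFact j)
      ≡⟨ cong₂ _*_ (cong (poch (μ - 1ℚ)) (ℕ.+-comm i j)) (*-comm (invFact i) (invFact j)) ⟩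
    poch (μ - 1ℚ) (j ℕ.+ i) * (invFact j * invFact i)
      ≡⟨ sym (weight-*-binom μ j i) ⟩
    weight μ j * b j i ∎

D-weighted-symmetry : ∀ μ s t n → Π< n (λ a → weight μ (s ℕ.+ a)) * D μ s t n ≡
                                  Π< n (λ a → weight μ (t ℕ.+ a)) * D μ t s n
D-weighted-symmetry μ s t n = begin
  Π< n (λ a → weight μ (s ℕ.+ a)) * D μ s t n
    ≡⟨ cong (_* D μ s t n) (sym (product≡Π< n (λ a → weight μ (s ℕ.+ a)))) ⟩
  product (weights s) * det n (entries s t)
    ≡⟨ sym (det-scaleRows n (weights s) (entries s t)) ⟩
  det n (λ a b → weights s a * entries s t a b)
    ≡⟨ det-cong n (λ a b → weight-entry-symmetric μ (s ℕ.+ toℕ a) (t ℕ.+ toℕ b)) ⟩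
  det n (λ a b → weights t b * entries t s b a)
    ≡⟨ det-transpose n (λ a b → weights t a * entries t s a b) ⟩
  det n (λ a b → weights t a * entries t s a b)
    ≡⟨ det-scaleRows n (weights t) (entries t s) ⟩
  product (weights t) * det n (entries t s)
    ≡⟨ cong (_* D μ t s n) (product≡Π< n (λ a → weight μ (t ℕ.+ a))) ⟩
  Π< n (λ a → weight μ (t ℕ.+ a)) * D μ t s n ∎
  where
  weights : ℕ → Fin n → ℚ
  weights s a = weight μ (s ℕ.+ toℕ a)

  entries : ℕ → ℕ → Fin n → Fin n → ℚ
  entries s t a b = entry μ (s ℕ.+ toℕ a) (t ℕ.+ toℕ b)

weight-suc : ∀ μ k → weight μ (suc k) ≡ weight μ k * ((μ - 1ℚ + ℕtoℚ k) * (ℤ.+ 1 / suc k))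
weight-suc μ k = begin
  poch (μ - 1ℚ) k * (μ - 1ℚ + ℕtoℚ k) * invFact (suc k)
    ≡⟨ cong (poch (μ - 1ℚ) k * (μ - 1ℚ + ℕtoℚ k) *_)
            (/-* (ℤ.+ 1) (ℤ.+ 1) (suc k) (factℕ k) {{_}} {{factℕ-nz k}} {{factℕ-nz (suc k)}}) ⟩
  poch (μ - 1ℚ) k * (μ - 1ℚ + ℕtoℚ k) * ((ℤ.+ 1 / suc k) * invFact k)
    ≡⟨ regroup (poch (μ - 1ℚ) k) (μ - 1ℚ + ℕtoℚ k) (ℤ.+ 1 / suc k) (invFact k) ⟩
  poch (μ - 1ℚ) k * invFact k * ((μ - 1ℚ + ℕtoℚ k) * (ℤ.+ 1 / suc k)) ∎
  where
  regroup : ∀ p y r f → p * y * (r * f) ≡ p * f * (y * r)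
  regroup = solve-∀ ℚ-ring

Π<-poch : ∀ n y c → Π< n (λ a → y + ℕtoℚ (c ℕ.+ a)) ≡ poch (y + ℕtoℚ c) n
Π<-poch zero    y c = refl
Π<-poch (suc n) y c =
  cong₂ _*_ (Π<-poch n y c)
            (trans (cong (y +_) (ℕtoℚ-+ c n)) (sym (+-assoc y (ℕtoℚ c) (ℕtoℚ n))))

Π<-invPochSuc : ∀ n c → Π< n (λ a → ℤ.+ 1 / suc (c ℕ.+ a)) ≡ invPochSuc c n
Π<-invPochSuc zero    c = refl
Π<-invPochSuc (suc n) c = trans (cong (_* (ℤ.+ 1 / suc (c ℕ.+ n))) (Π<-invPochSuc n c))
  (sym (/-* (ℤ.+ 1) (ℤ.+ 1) (pochSuc c n) (suc (c ℕ.+ n))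
            {{pochSuc-nz c n}} {{_}} {{pochSuc-nz c (suc n)}}))

Π<-weight-suc : ∀ μ n c →
  Π< n (λ a → weight μ (suc c ℕ.+ a)) ≡
  Π< n (λ a → weight μ (c ℕ.+ a)) * (poch (μ + ℕtoℚ c - 1ℚ) n * invPochSuc c n)
Π<-weight-suc μ n c = begin
  Π< n (λ a → weight μ (suc (c ℕ.+ a)))
    ≡⟨ Π<-cong n (λ a → weight-suc μ (c ℕ.+ a)) ⟩
  Π< n (λ a → weight μ (c ℕ.+ a) * (step a * inv a))
    ≡⟨ Π<-distrib-* n (λ a → weight μ (c ℕ.+ a)) (λ a → step a * inv a) ⟩
  W * Π< n (λ a → step a * inv a)
    ≡⟨ cong (W *_) (Π<-distrib-* n step inv) ⟩
  W * (Π< n step * Π< n inv)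
    ≡⟨ cong₂ (λ u v → W * (u * v)) (Π<-poch n (μ - 1ℚ) c) (Π<-invPochSuc n c) ⟩
  W * (poch (μ - 1ℚ + ℕtoℚ c) n * invPochSuc c n)
    ≡⟨ cong (λ z → W * (poch z n * invPochSuc c n)) (swap μ (ℕtoℚ c)) ⟩
  W * (poch (μ + ℕtoℚ c - 1ℚ) n * invPochSuc c n) ∎
  where
  W = Π< n (λ a → weight μ (c ℕ.+ a))

  step inv : ℕ → ℚ
  step a = μ - 1ℚ + ℕtoℚ (c ℕ.+ a)
  inv  a = ℤ.+ 1 / suc (c ℕ.+ a)

  swap : ∀ μ x → μ - 1ℚ + x ≡ μ + x - 1ℚ
  swap = solve-∀ ℚ-ring

weight-telescope : ∀ μ s n d → Π< n (λ a → weight μ (d ℕ.+ s ℕ.+ a)) ≡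
                               Π< d (factor μ s n) * Π< n (λ a → weight μ (s ℕ.+ a))
weight-telescope μ s n zero    = sym (*-identityˡ _)
weight-telescope μ s n (suc d) = begin
  Π< n (λ a → weight μ (suc (d ℕ.+ s) ℕ.+ a))
    ≡⟨ Π<-weight-suc μ n (d ℕ.+ s) ⟩
  Π< n (λ a → weight μ (d ℕ.+ s ℕ.+ a)) * factor μ s n d
    ≡⟨ cong (_* factor μ s n d) (weight-telescope μ s n d) ⟩
  Π< d (factor μ s n) * W * factor μ s n d
    ≡⟨ xy∙z≈xz∙y (Π< d (factor μ s n)) W (factor μ s n d) ⟩
  Π< (suc d) (factor μ s n) * W ∎
  where
  W = Π< n (λ a → weight μ (s ℕ.+ a))

poch-positive : ∀ y → Positive y → ∀ i → Positive (poch y i)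
poch-positive y pos zero    = normalize-pos 1 1
poch-positive y pos (suc i) = pos*pos⇒pos (poch y i) {{poch-positive y pos i}}
  (y + ℕtoℚ i) {{pos+nonNeg⇒pos y {{pos}} (ℕtoℚ i) {{normalize-nonNeg i 1}}}}

weight-positive : ∀ k i → Positive (weight (ℕtoℚ (2 ℕ.+ k)) i)
weight-positive k i = pos*pos⇒pos (poch (ℕtoℚ (2 ℕ.+ k) - 1ℚ) i) {{poch-positive′}}
                                  (invFact i) {{normalize-pos 1 (factℕ i) {{factℕ-nz i}}}}
  where
  cancel : ∀ y → 1ℚ + y - 1ℚ ≡ y
  cancel = solve-∀ ℚ-ring

  shifted : ℕtoℚ (2 ℕ.+ k) - 1ℚ ≡ ℕtoℚ (suc k)
  shifted = trans (cong (_- 1ℚ) (ℕtoℚ-+ 1 (suc k))) (cancel (ℕtoℚ (suc k)))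

  poch-positive′ : Positive (poch (ℕtoℚ (2 ℕ.+ k) - 1ℚ) i)
  poch-positive′ = subst (λ y → Positive (poch y i)) (sym shifted)
                         (poch-positive (ℕtoℚ (suc k)) (normalize-pos (suc k) 1) i)

D-reflection-if-weights≢0 : ∀ μ s d n → .{{_ : NonZero (Π< n (λ a → weight μ (s ℕ.+ a)))}} →
                            D μ s (d ℕ.+ s) n ≡ Π< d (factor μ s n) * D μ (d ℕ.+ s) s n
D-reflection-if-weights≢0 μ s d n = *-cancelˡ-≡ W (begin
  W * D μ s t n                                ≡⟨ D-weighted-symmetry μ s t n ⟩
  Π< n (λ a → weight μ (t ℕ.+ a)) * D μ t s n  ≡⟨ cong (_* D μ t s n) (weight-telescope μ s n d) ⟩
  F * W * D μ t s n                            ≡⟨ cong (_* D μ t s n) (*-comm F W) ⟩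
  W * F * D μ t s n                            ≡⟨ *-assoc W F (D μ t s n) ⟩
  W * (F * D μ t s n)                          ∎)
  where
  t = d ℕ.+ s
  W = Π< n (λ a → weight μ (s ℕ.+ a))
  F = Π< d (factor μ s n)

D-reflection : ∀ μ s d n → D μ s (d ℕ.+ s) n ≡ Π< d (factor μ s n) * D μ (d ℕ.+ s) s n
D-reflection μ s d n =
  polynomial-identity (poly-D s (d ℕ.+ s) n)
                      (poly-* (poly-Π< d (λ μ → factor μ s n) (poly-factor s n)) (poly-D (d ℕ.+ s) s n))
                      (λ k → ℕtoℚ (2 ℕ.+ k)) (ℕ.suc-injective ∘ ℕ.suc-injective ∘ ℕtoℚ-injective)
                      agree-at-integers μ
  where
  agree-at-integers : ∀ k → D (ℕtoℚ (2 ℕ.+ k)) s (d ℕ.+ s) n ≡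
                            Π< d (factor (ℕtoℚ (2 ℕ.+ k)) s n) * D (ℕtoℚ (2 ℕ.+ k)) (d ℕ.+ s) s n
  agree-at-integers k = D-reflection-if-weights≢0 μₖ s d n {{pos⇒nonZero W {{W-positive}}}}
    where
    μₖ = ℕtoℚ (2 ℕ.+ k)
    W = Π< n (λ a → weight μₖ (s ℕ.+ a))
    W-positive = Π<-positive n (λ a → weight μₖ (s ℕ.+ a)) (weight-positive k ∘ (s ℕ.+_))

theorem17 : (μ : ℚ) (s t n : ℕ) → s ≤ t → n ≥ 1 →
    D μ s t n ≡ Π< (t ∸ s) (factor μ s n) * D μ t s n
theorem17 μ s t n s≤t _ =
  subst (λ t′ → D μ s t′ n ≡ Π< (t ∸ s) (factor μ s n) * D μ t′ s n)
        (ℕ.m∸n+n≡m s≤t)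
        (D-reflection μ s (t ∸ s) n)
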